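{- Let $Z$ be a multimatroid with a total ordering $\prec$ of its skew classes and let $T$ be a transversal of $Z$. Then $T$ is $(Z,\prec)$-cocompatible if and only if $\mathrm{ccl}_{\prec}(T)=T$.
   Context: A carrier is a pair $(U,\Omega)$, $U$ finite, $\Omega$ a partition of $U$ into non-empty skew classes; subtransversals meet each skew class at most once, transversals exactly once; skew pair: two distinct elements of a skew class. A multimatroid $Z=(U,\Omega,r)$ has a non-negative integer $r$ on subtransversals with (R1) on each transversal $r$ is a matroid rank function; (R2) for subtransversal $S$ and skew pair $\{x,y\}$ in a skew class disjoint from $S$, $r(S\cup\{x\})+r(S\cup\{y\})-2r(S)\ge1$. Circuits are minimal subtransversals $S$ with $r(S)<|S|$. $S_\omega$ is the element of $S\cap\omega$. The total order $\prec$ on skew classes induces an order on any subtransversal; $\min(C)$ is its least element. For a transversal $T$, skew class $\omega$ is active w.r.t. $T$ if there is a circuit $C$ with $\min(C)\in\omega$ and $C-\omega\subseteq T$, inactive otherwise; all such circuits have the same least element, denoted $\underline T_\omega$. $\mathrm{ccl}_\prec(T)$ is the transversal with $(\mathrm{ccl}_\prec(T))_\omega=\underline T_\omega$ for active $\omega$ and $T_\omega$ for inactive $\omega$. $T$ is $(Z,\prec)$-cocompatible if no circuit $C$ satisfies $C-T=\{\min(C)\}$. -}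

module Defs where

open import Data.Nat using (ℕ; _+_; _*_; _≤_; _<_)
open import Data.Fin using (Fin)
open import Data.Fin.Subset using (Subset; _∈_; _∉_; _⊆_; _∪_; _∩_; ⁅_⁆; ∣_∣)
open import Data.Product using (Σ; ∃; _×_)
open import Data.Sum using (_⊎_)
open import Relation.Binary.PropositionalEquality using (_≡_; _≢_)
open import Relation.Binary using (Rel; IsStrictTotalOrder)
open import Relation.Nullary using (¬_)
open import Level using (0ℓ)

-- The ground set U is Fin n, the skew classes are indexed by
-- Fin m, and  cls : Fin n → Fin m  sends an element to its skew class.
-- The partition into non-empty skew classes corresponds to cls being
-- surjective.

record Carrier : Set where
  field
    n     : ℕ
    m     : ℕ
    cls   : Fin n → Fin m
    cls-surjective : (ω : Fin m) → ∃ λ x → cls x ≡ ω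

module CarrierNotions (K : Carrier) where
  open Carrier K

  IsSubtransversal : Subset n → Set
  IsSubtransversal S = ∀ x y → x ∈ S → y ∈ S → cls x ≡ cls y → x ≡ y

  IsTransversal : Subset n → Set
  IsTransversal T = IsSubtransversal T × ((ω : Fin m) → ∃ λ x → x ∈ T × cls x ≡ ω)

  IsMatroidRankOn : (Subset n → ℕ) → Subset n → Set
  IsMatroidRankOn r T =
      (∀ A → A ⊆ T → r A ≤ ∣ A ∣)
    × (∀ A B → A ⊆ B → B ⊆ T → r A ≤ r B)
    × (∀ A B → A ⊆ T → B ⊆ T → r (A ∪ B) + r (A ∩ B) ≤ r A + r B)

-- Multimatroids.  The rank r is given on all subsets of U, but only its
-- values on subtransversals are constrained (and used below).

record Multimatroid : Set where
  field
    carrier : Carrier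
  open Carrier carrier public
  open CarrierNotions carrier public
  field
    r  : Subset n → ℕ
    R1 : ∀ T → IsTransversal T → IsMatroidRankOn r T
    R2 : ∀ S x y → IsSubtransversal S → x ≢ y → cls x ≡ cls y
         → (∀ z → z ∈ S → cls z ≢ cls x)
         → 1 + 2 * r S ≤ r (S ∪ ⁅ x ⁆) + r (S ∪ ⁅ y ⁆)

module MultimatroidNotions (Z : Multimatroid)
         (_≺_ : Rel (Fin (Multimatroid.m Z)) 0ℓ)
         (≺-total : IsStrictTotalOrder _≡_ _≺_) where
  open Multimatroid Z

  IsCircuit : Subset n → Set
  IsCircuit C = IsSubtransversal C × r C < ∣ C ∣
              × (∀ D → D ⊆ C → IsSubtransversal D → r D < ∣ D ∣ → D ≡ C)

  IsMinOf : Subset n → Fin n → Set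
  IsMinOf C x = x ∈ C × (∀ y → y ∈ C → y ≢ x → cls x ≺ cls y)

  Witness : Subset n → Fin m → Subset n → Fin n → Set
  Witness T ω C x = IsCircuit C × IsMinOf C x × cls x ≡ ω
                  × (∀ y → y ∈ C → cls y ≢ ω → y ∈ T)

  IsActive : Subset n → Fin m → Set
  IsActive T ω = ∃ λ C → ∃ λ x → Witness T ω C x

  -- T' = ccl(T) (relationally): for active ω, T'_ω is the least element
  -- (underline T_ω) of a circuit witnessing activity; for inactive ω,
  -- T'_ω = T_ω.
  IsCcl : Subset n → Subset n → Set
  IsCcl T T' = IsTransversal T' ×
    (∀ x → (x ∈ T' → (IsActive T (cls x) × ∃ λ C → Witness T (cls x) C x)
                      ⊎ (¬ IsActive T (cls x) × x ∈ T))
         × ((IsActive T (cls x) × ∃ λ C → Witness T (cls x) C x)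
                      ⊎ (¬ IsActive T (cls x) × x ∈ T) → x ∈ T'))

  IsCocompatible : Subset n → Set
  IsCocompatible T = ¬ (∃ λ C → ∃ λ x → IsCircuit C × IsMinOf C x × x ∉ T
                         × (∀ y → y ∈ C → y ≢ x → y ∈ T))

{-# OPTIONS --safe #-}
-- Every circuit C witnessing activity of a class ω has C − ω ⊆ T, so
-- cocompatibility forces its least element into T; since T is a transversal
-- that element is T_ω.  Hence ccl fixes T.  Conversely a circuit C with
-- C − T = {min C} witnesses activity of the class of min C, so if ccl fixes T
-- then min C ∈ T, which is absurd.  Activity is decidable because everything
-- in sight is finite, which gives the case split between active and inactive
-- classes.
module Submission where

open import Defs
open import Data.Bool.Properties using () renaming (_≟_ to _≟ᴮ_)
open import Data.Fin using (Fin) renaming (_≟_ to _≟ᶠ_)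
open import Data.Fin.Properties using (all?; any?)
open import Data.Fin.Subset using (Subset; _∈_; ∣_∣)
open import Data.Fin.Subset.Properties using (_∈?_; _⊆?_; anySubset?)
open import Data.Nat.Properties using () renaming (_<?_ to _<ᴺ?_)
open import Data.Product using (∃; _×_; _,_; proj₂)
open import Data.Sum using (_⊎_; inj₁; inj₂)
open import Data.Vec.Properties using (≡-dec)
open import Function.Bundles using (_⇔_; mk⇔)
open import Level using (0ℓ)
open import Relation.Binary using (Rel; IsStrictTotalOrder)
open import Relation.Binary.PropositionalEquality using (_≡_; _≢_; refl; sym)
open import Relation.Nullary using (¬_; Dec; yes; no)
open import Relation.Nullary.Decidable using (_×-dec_; _→-dec_; ¬?; decidable-stable)
open import Relation.Unary using (Pred; Decidable)

allSubset? : ∀ {k ℓ} {P : Pred (Subset k) ℓ} → Decidable P → Dec (∀ D → P D)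
allSubset? P? with anySubset? (λ D → ¬? (P? D))
... | yes (D , ¬PD) = no (λ ∀P → ¬PD (∀P D))
... | no ∄¬P        = yes (λ D → decidable-stable (P? D) (λ ¬PD → ∄¬P (D , ¬PD)))

module _ (Z : Multimatroid) (_≺_ : Rel (Fin (Multimatroid.m Z)) 0ℓ)
         (≺-total : IsStrictTotalOrder _≡_ _≺_) where
  open Multimatroid Z
  open MultimatroidNotions Z _≺_ ≺-total
  open IsStrictTotalOrder ≺-total using (irrefl) renaming (_<?_ to _≺?_)

  isSubtransversal? : Decidable IsSubtransversal
  isSubtransversal? S = all? λ x → all? λ y →
    (x ∈? S) →-dec (y ∈? S) →-dec (cls x ≟ᶠ cls y) →-dec (x ≟ᶠ y)

  isCircuit? : Decidable IsCircuit
  isCircuit? C = isSubtransversal? C ×-dec (r C <ᴺ? ∣ C ∣) ×-dec allSubset? λ D →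
    (D ⊆? C) →-dec isSubtransversal? D →-dec (r D <ᴺ? ∣ D ∣) →-dec ≡-dec _≟ᴮ_ D C

  isMinOf? : ∀ C x → Dec (IsMinOf C x)
  isMinOf? C x = (x ∈? C) ×-dec all? λ y →
    (y ∈? C) →-dec ¬? (y ≟ᶠ x) →-dec (cls x ≺? cls y)

  witness? : ∀ T ω C x → Dec (Witness T ω C x)
  witness? T ω C x = isCircuit? C ×-dec isMinOf? C x ×-dec (cls x ≟ᶠ ω) ×-dec
    all? λ y → (y ∈? C) →-dec ¬? (cls y ≟ᶠ ω) →-dec (y ∈? T)

  isActive? : ∀ T ω → Dec (IsActive T ω)
  isActive? T ω = anySubset? λ C → any? λ x → witness? T ω C x

  witness-others∈T : ∀ {T ω C x} → Witness T ω C x → ∀ y → y ∈ C → y ≢ x → y ∈ T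
  witness-others∈T (_ , (_ , x-least) , refl , C-ω⊆T) y y∈C y≢x =
    C-ω⊆T y y∈C (λ cy≡cx → irrefl (sym cy≡cx) (x-least y y∈C y≢x))

  circuit-witness : ∀ {T C x} → IsCircuit C → IsMinOf C x →
                    (∀ y → y ∈ C → y ≢ x → y ∈ T) → Witness T (cls x) C x
  circuit-witness circuit min C-x⊆T =
    circuit , min , refl , λ y y∈C cy≢cx → C-x⊆T y y∈C (λ { refl → cy≢cx refl })

  module _ {T : Subset n} where

    CclElement : Fin n → Set
    CclElement x = (IsActive T (cls x) × ∃ λ C → Witness T (cls x) C x)
                 ⊎ (¬ IsActive T (cls x) × x ∈ T)

    cocompatible⇒witness-min∈T : ∀ {ω C x} → IsCocompatible T → Witness T ω C x → x ∈ T
    cocompatible⇒witness-min∈T {C = C} {x} cocompatible w@(circuit , min , _) =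
      decidable-stable (x ∈? T) λ x∉T →
        cocompatible (C , x , circuit , min , x∉T , witness-others∈T w)

    cocompatible⇒witness-at : IsTransversal T → IsCocompatible T → ∀ {x} → x ∈ T →
                              IsActive T (cls x) → ∃ λ C → Witness T (cls x) C x
    cocompatible⇒witness-at (subtransversal , _) cocompatible x∈T (C , x′ , w@(_ , _ , cx′≡cx , _))
      with subtransversal _ _ (cocompatible⇒witness-min∈T cocompatible w) x∈T cx′≡cx
    ... | refl = C , w

    cocompatible⇒ccl-fixed : IsTransversal T → IsCocompatible T → IsCcl T T
    cocompatible⇒ccl-fixed transversal cocompatible =
      transversal , λ x → classify x , included x
      where
      classify : ∀ x → x ∈ T → CclElement x
      classify x x∈T with isActive? T (cls x)
      ... | yes active = inj₁ (active , cocompatible⇒witness-at transversal cocompatible x∈T active)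
      ... | no inactive = inj₂ (inactive , x∈T)

      included : ∀ x → CclElement x → x ∈ T
      included x (inj₁ (_ , _ , w)) = cocompatible⇒witness-min∈T cocompatible w
      included x (inj₂ (_ , x∈T))   = x∈T

    ccl-fixed⇒cocompatible : IsCcl T T → IsCocompatible T
    ccl-fixed⇒cocompatible (_ , ccl) (C , x , circuit , min , x∉T , C-x⊆T) =
      x∉T (proj₂ (ccl x) (inj₁ ((C , x , w) , C , w)))
      where
      w : Witness T (cls x) C x
      w = circuit-witness circuit min C-x⊆T

proposition4p8 : (Z : Multimatroid) (_≺_ : Rel (Fin (Multimatroid.m Z)) 0ℓ)
    (≺-total : IsStrictTotalOrder _≡_ _≺_)
    (T : Subset (Multimatroid.n Z))
    → Multimatroid.IsTransversal Z T
    → MultimatroidNotions.IsCocompatible Z _≺_ ≺-total T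
      ⇔ MultimatroidNotions.IsCcl Z _≺_ ≺-total T T
proposition4p8 Z _≺_ ≺-total T transversal =
  mk⇔ (cocompatible⇒ccl-fixed Z _≺_ ≺-total transversal)
      (ccl-fixed⇒cocompatible Z _≺_ ≺-total)
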